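{- Let $\mathbf{w}\in\mathbb{Z}_2^n$ have Hamming weight smaller than $n/2$, and suppose the cyclic game $C(\mathbf{w})$ is proper. Then $C(\mathbf{w})$ is not roughly weighted.
   Context: A simple game is $(P,W)$ with $P=[n]$, $W\subseteq 2^P$ (winning coalitions) closed under supersets within $P$, $W\ne\emptyset$, $W\ne 2^P$; other coalitions are losing; it is determined by its minimal winning coalitions. The cyclic game $C(\mathbf{w})$ is the simple game on $[n]$ whose minimal winning coalitions are exactly those whose characteristic vectors are $\mathbf{w}$ and all its cyclic permutations (cyclic shifts of coordinates). A game is proper if $X\in W$ implies $P\setminus X\notin W$. A game is roughly weighted if there exist non-negative reals $w_1,\dots,w_n$ and a real $q$, not all zero, such that $\sum_{i\in X}w_i<q$ implies $X$ is losing and $\sum_{i\in X}w_i>q$ implies $X$ is winning.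
   Formalization: The weights $w_1,\dots,w_n$ and the number $q$ in the definition of a roughly weighted game are taken in ℚ instead of the reals. -}

module Defs where

open import Data.Nat using (ℕ; zero; suc)
open import Data.Bool using (Bool; true; false)
open import Data.Fin using (Fin; toℕ)
open import Data.Vec using (Vec; []; _∷_; _∷ʳ_)
open import Data.Fin.Subset using (Subset; _⊆_; ∁)
open import Data.Product using (Σ; ∃; _×_; _,_)
open import Data.Sum using (_⊎_)
open import Data.Rational using (ℚ; 0ℚ; _+_; _<_; _≤_)
open import Relation.Nullary using (¬_)
open import Relation.Binary.PropositionalEquality using (_≡_)

rotate : ∀ {A : Set} {n : ℕ} → Vec A n → Vec A n
rotate []       = []
rotate (x ∷ xs) = xs ∷ʳ x

rotateⁿ : ∀ {A : Set} {n : ℕ} → ℕ → Vec A n → Vec A n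
rotateⁿ zero    v = v
rotateⁿ (suc k) v = rotate (rotateⁿ k v)

Game : ℕ → Set₁
Game n = Subset n → Set

-- Cyclic game C(w): minimal winning coalitions are the cyclic shifts of w,
-- so a coalition is winning iff it contains some cyclic shift of w.
Cyclic : ∀ {n} → Subset n → Game n
Cyclic {n} w X = Σ (Fin n) λ k → rotateⁿ (toℕ k) w ⊆ X

Proper : ∀ {n} → Game n → Set
Proper {n} G = (X : Subset n) → G X → ¬ G (∁ X)

weightOf : ∀ {n} → Vec ℚ n → Subset n → ℚ
weightOf []       []          = 0ℚ
weightOf (a ∷ as) (true ∷ X)  = a + weightOf as X
weightOf (a ∷ as) (false ∷ X) = weightOf as X

NonNeg : ∀ {n} → Vec ℚ n → Set
NonNeg []       = Data.Unit.⊤ where import Data.Unit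
NonNeg (a ∷ as) = (0ℚ ≤ a) × NonNeg as

SomeNonZero : ∀ {n} → Vec ℚ n → Set
SomeNonZero []       = Data.Empty.⊥ where import Data.Empty
SomeNonZero (a ∷ as) = ¬ (a ≡ 0ℚ) ⊎ SomeNonZero as

RoughlyWeighted : ∀ {n} → Game n → Set
RoughlyWeighted {n} G =
  ∃ λ (ws : Vec ℚ n) → ∃ λ (q : ℚ) →
    NonNeg ws × (SomeNonZero ws ⊎ ¬ (q ≡ 0ℚ)) ×
    ((X : Subset n) → weightOf ws X < q → ¬ G X) ×
    ((X : Subset n) → q < weightOf ws X → G X)

-- Let ω be rough weights with quota q. Every cyclic shift wᵢ of w is winning
-- and, the game being proper, its complement is losing; so ω(wᵢ) ≥ q ≥ ω(∁ wᵢ),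
-- whence 2ω(wᵢ) ≥ ω(P). Each player lies in exactly ∣w∣ of the n shifts, so
-- summing over i gives n·ω(P) ≤ 2∣w∣·ω(P). As 2∣w∣ < n the total weight ω(P)
-- vanishes; then every weight is 0 and q = 0 too, which rough weights forbid.
module Submission where

open import Defs
open import Data.Nat using (ℕ; _*_; _<_)
open import Data.Fin.Subset using (Subset; ∣_∣)
open import Relation.Nullary using (¬_)

open import Algebra.Bundles using (CommutativeMonoid)
open import Data.Bool using (Bool; true; false)
open import Data.Fin using (fromℕ<)
open import Data.Fin.Properties using (toℕ-fromℕ<)
open import Data.Fin.Subset using (⊤; ∁; _⊆_)
open import Data.List using (List; []; _∷_; _++_; length)
open import Data.List.Properties using (∷-injective; ++-assoc; ++-identityʳ)
open import Data.Nat using (zero; suc; _+_; z<s; s<s)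
import Data.Nat.Properties as ℕ
open import Data.Product using (_,_)
open import Data.Rational using (ℚ; 0ℚ) renaming (_+_ to _+ℚ_; _≤_ to _≤ℚ_; _<_ to _<ℚ_)
import Data.Rational.Properties as ℚ
open import Data.Sum using ([_,_]; inj₁; inj₂)
open import Data.Vec using (Vec; _∷_; _∷ʳ_; head; map; replicate; sum; toList; zipWith)
  renaming ([] to []ᵥ)
open import Data.Vec.Properties using (map-∷ʳ; toList-∷ʳ; length-toList; toList-injective)
  renaming (∷-injective to ∷-injectiveᵥ)
open import Data.Vec.Relation.Binary.Equality.Cast using (cast-is-id)
open import Function using (_∘_; id)
open import Relation.Binary.PropositionalEquality using (_≡_; refl; sym; trans; cong; cong₂; subst; module ≡-Reasoning)

open import Algebra.Properties.CommutativeMonoid.Mult ℚ.+-0-commutativeMonoid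
  using (_×_; ×-homo-+; ×-distrib-+)
import Algebra.Properties.CommutativeSemigroup as CommutativeSemigroupProperties
module ℕ+ = CommutativeSemigroupProperties ℕ.+-commutativeSemigroup
module ℚ+ = CommutativeSemigroupProperties
  (CommutativeMonoid.commutativeSemigroup ℚ.+-0-commutativeMonoid)

private
  variable
    A B : Set
    n : ℕ

rotateⁿ-suc : ∀ k (v : Vec A n) → rotateⁿ (suc k) v ≡ rotateⁿ k (rotate v)
rotateⁿ-suc zero    v = refl
rotateⁿ-suc (suc k) v = cong rotate (rotateⁿ-suc k v)

toList-rotateⁿ : ∀ (xs ys : List A) (v : Vec A n) →
                 toList v ≡ xs ++ ys → toList (rotateⁿ (length xs) v) ≡ ys ++ xs
toList-rotateⁿ []       ys v eq = trans eq (sym (++-identityʳ ys))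
toList-rotateⁿ (x ∷ xs) ys (y ∷ v) eq with ∷-injective eq
... | refl , v≡xs++ys = begin
  toList (rotateⁿ (suc (length xs)) (x ∷ v)) ≡⟨ cong toList (rotateⁿ-suc (length xs) (x ∷ v)) ⟩
  toList (rotateⁿ (length xs) (v ∷ʳ x))      ≡⟨ toList-rotateⁿ xs (ys ++ x ∷ []) (v ∷ʳ x) v∷ʳx≡ ⟩
  (ys ++ x ∷ []) ++ xs                       ≡⟨ ++-assoc ys (x ∷ []) xs ⟩
  ys ++ x ∷ xs                               ∎
  where
  open ≡-Reasoning
  v∷ʳx≡ : toList (v ∷ʳ x) ≡ xs ++ ys ++ x ∷ []
  v∷ʳx≡ = trans (toList-∷ʳ x v) (trans (cong (_++ x ∷ []) v≡xs++ys) (++-assoc xs ys (x ∷ [])))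

rotateⁿ-period : (v : Vec A n) → rotateⁿ n v ≡ v
rotateⁿ-period {n = n} v = trans (sym (cast-is-id refl _)) (toList-injective refl _ v toList≡)
  where
  toList≡ : toList (rotateⁿ n v) ≡ toList v
  toList≡ = subst (λ k → toList (rotateⁿ k v) ≡ [] ++ toList v) (length-toList v)
              (toList-rotateⁿ (toList v) [] v (sym (++-identityʳ (toList v))))

rotate-map : (f : A → B) (v : Vec A n) → rotate (map f v) ≡ map f (rotate v)
rotate-map f []ᵥ     = refl
rotate-map f (x ∷ v) = sym (map-∷ʳ f x v)

rotateⁿ-map : ∀ (f : A → B) k (v : Vec A n) → rotateⁿ k (map f v) ≡ map f (rotateⁿ k v)
rotateⁿ-map f zero    v = refl
rotateⁿ-map f (suc k) v = trans (cong rotate (rotateⁿ-map f k v)) (rotate-map f (rotateⁿ k v))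

zipWith-∷ʳ : ∀ (f : A → A → B) (u v : Vec A n) x y →
             zipWith f (u ∷ʳ x) (v ∷ʳ y) ≡ zipWith f u v ∷ʳ f x y
zipWith-∷ʳ f []ᵥ      []ᵥ      x y = refl
zipWith-∷ʳ f (a ∷ u) (b ∷ v) x y = cong (f a b ∷_) (zipWith-∷ʳ f u v x y)

rotate-zipWith : ∀ (f : A → A → B) (u v : Vec A n) →
                 rotate (zipWith f u v) ≡ zipWith f (rotate u) (rotate v)
rotate-zipWith f []ᵥ     []ᵥ     = refl
rotate-zipWith f (x ∷ u) (y ∷ v) = sym (zipWith-∷ʳ f u v x y)

replicate-∷ʳ : ∀ n (x : A) → replicate n x ∷ʳ x ≡ x ∷ replicate n x
replicate-∷ʳ zero    x = refl
replicate-∷ʳ (suc n) x = cong (x ∷_) (replicate-∷ʳ n x)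

rotate-replicate : ∀ n (x : A) → rotate (replicate n x) ≡ replicate n x
rotate-replicate zero    x = refl
rotate-replicate (suc n) x = replicate-∷ʳ n x

∷ʳ≡∷⇒replicate : ∀ x (v : Vec A n) → v ∷ʳ x ≡ x ∷ v → v ≡ replicate n x
∷ʳ≡∷⇒replicate x []ᵥ     _  = refl
∷ʳ≡∷⇒replicate x (y ∷ v) eq with ∷-injectiveᵥ eq
... | refl , v∷ʳx≡x∷v = cong (y ∷_) (∷ʳ≡∷⇒replicate y v v∷ʳx≡x∷v)

rotate-fixed⇒replicate : (v : Vec A (suc n)) → rotate v ≡ v → v ≡ replicate (suc n) (head v)
rotate-fixed⇒replicate (x ∷ v) eq = cong (x ∷_) (∷ʳ≡∷⇒replicate x v eq)

zipWith-comm : ∀ {f : A → A → B} → (∀ x y → f x y ≡ f y x) →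
               (u v : Vec A n) → zipWith f u v ≡ zipWith f v u
zipWith-comm comm []ᵥ     []ᵥ     = refl
zipWith-comm comm (x ∷ u) (y ∷ v) = cong₂ _∷_ (comm x y) (zipWith-comm comm u v)

zipWith-assoc : ∀ {f : A → A → A} → (∀ x y z → f (f x y) z ≡ f x (f y z)) →
                (u v w : Vec A n) → zipWith f (zipWith f u v) w ≡ zipWith f u (zipWith f v w)
zipWith-assoc assoc []ᵥ     []ᵥ     []ᵥ     = refl
zipWith-assoc assoc (x ∷ u) (y ∷ v) (z ∷ w) = cong₂ _∷_ (assoc x y z) (zipWith-assoc assoc u v w)

sum-zipWith-+ : (u v : Vec ℕ n) → sum (zipWith _+_ u v) ≡ sum u + sum v
sum-zipWith-+ []ᵥ     []ᵥ     = refl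
sum-zipWith-+ (x ∷ u) (y ∷ v) = trans (cong (x + y +_) (sum-zipWith-+ u v)) (ℕ+.interchange x y _ _)

sum-∷ʳ : ∀ (v : Vec ℕ n) x → sum (v ∷ʳ x) ≡ x + sum v
sum-∷ʳ []ᵥ     x = refl
sum-∷ʳ (y ∷ v) x = trans (cong (y +_) (sum-∷ʳ v x)) (ℕ+.x∙yz≈y∙xz y x (sum v))

sum-rotate : (v : Vec ℕ n) → sum (rotate v) ≡ sum v
sum-rotate []ᵥ     = refl
sum-rotate (x ∷ v) = sum-∷ʳ v x

sum-rotateⁿ : ∀ k (v : Vec ℕ n) → sum (rotateⁿ k v) ≡ sum v
sum-rotateⁿ zero    v = refl
sum-rotateⁿ (suc k) v = trans (sum-rotate (rotateⁿ k v)) (sum-rotateⁿ k v)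

sum-replicate : ∀ n c → sum (replicate n c) ≡ n * c
sum-replicate zero    c = refl
sum-replicate (suc n) c = cong (c +_) (sum-replicate n c)

-- A vector in Vec ℕ n is a multiset of players, listing each one's multiplicity.

infixl 6 _⊕_
_⊕_ : Vec ℕ n → Vec ℕ n → Vec ℕ n
_⊕_ = zipWith _+_

∑ᵥ : ℕ → (ℕ → Vec ℕ n) → Vec ℕ n
∑ᵥ {n} zero    g = replicate n 0
∑ᵥ     (suc m) g = g 0 ⊕ ∑ᵥ m (g ∘ suc)

∑ᵥ-suc : ∀ m (g : ℕ → Vec ℕ n) → ∑ᵥ (suc m) g ≡ ∑ᵥ m g ⊕ g m
∑ᵥ-suc zero    g = zipWith-comm ℕ.+-comm (g 0) _
∑ᵥ-suc (suc m) g = trans (cong (g 0 ⊕_) (∑ᵥ-suc m (g ∘ suc)))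
                         (sym (zipWith-assoc ℕ.+-assoc (g 0) _ _))

rotate-∑ᵥ : ∀ m (g : ℕ → Vec ℕ n) → rotate (∑ᵥ m g) ≡ ∑ᵥ m (rotate ∘ g)
rotate-∑ᵥ {n} zero    g = rotate-replicate n 0
rotate-∑ᵥ     (suc m) g =
  trans (rotate-zipWith _+_ (g 0) _) (cong (rotate (g 0) ⊕_) (rotate-∑ᵥ m (g ∘ suc)))

sum-∑ᵥ : ∀ m (g : ℕ → Vec ℕ n) s → (∀ j → sum (g j) ≡ s) → sum (∑ᵥ m g) ≡ m * s
sum-∑ᵥ {n} zero    g s eq = trans (sum-replicate n 0) (ℕ.*-zeroʳ n)
sum-∑ᵥ     (suc m) g s eq =
  trans (sum-zipWith-+ (g 0) _) (cong₂ _+_ (eq 0) (sum-∑ᵥ m (g ∘ suc) s (eq ∘ suc)))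

-- The sum of all rotations is rotation-invariant, hence constant; comparing
-- totals identifies the constant.
∑ᵥ-rotations : (v : Vec ℕ n) → ∑ᵥ n (λ j → rotateⁿ j v) ≡ replicate n (sum v)
∑ᵥ-rotations {zero}  []ᵥ = refl
∑ᵥ-rotations {suc n} v   = trans V≡const (cong (replicate (suc n)) head≡sum)
  where
  open ≡-Reasoning
  g : ℕ → Vec ℕ (suc n)
  g j = rotateⁿ j v
  V = ∑ᵥ (suc n) g
  rotate-V : rotate V ≡ V
  rotate-V = begin
    rotate V                      ≡⟨ rotate-∑ᵥ (suc n) g ⟩
    ∑ᵥ (suc n) (g ∘ suc)          ≡⟨ ∑ᵥ-suc n (g ∘ suc) ⟩
    ∑ᵥ n (g ∘ suc) ⊕ g (suc n)    ≡⟨ cong (∑ᵥ n (g ∘ suc) ⊕_) (rotateⁿ-period v) ⟩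
    ∑ᵥ n (g ∘ suc) ⊕ v            ≡⟨ zipWith-comm ℕ.+-comm _ v ⟩
    V                             ∎
  V≡const : V ≡ replicate (suc n) (head V)
  V≡const = rotate-fixed⇒replicate V rotate-V
  head≡sum : head V ≡ sum v
  head≡sum = ℕ.*-cancelˡ-≡ (head V) (sum v) (suc n) (begin
    suc n * head V                   ≡⟨ sum-replicate (suc n) (head V) ⟨
    sum (replicate (suc n) (head V)) ≡⟨ cong sum V≡const ⟨
    sum V                            ≡⟨ sum-∑ᵥ (suc n) g (sum v) (λ j → sum-rotateⁿ j v) ⟩
    suc n * sum v                    ∎)

indicator : Bool → ℕ
indicator true  = 1
indicator false = 0

sum-indicator : (X : Subset n) → sum (map indicator X) ≡ ∣ X ∣
sum-indicator []ᵥ         = refl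
sum-indicator (true ∷ X)  = cong suc (sum-indicator X)
sum-indicator (false ∷ X) = sum-indicator X

multiWeight : Vec ℚ n → Vec ℕ n → ℚ
multiWeight []ᵥ      []ᵥ      = 0ℚ
multiWeight (a ∷ ws) (m ∷ ms) = m × a +ℚ multiWeight ws ms

weightOf≡multiWeight : (ws : Vec ℚ n) (X : Subset n) → weightOf ws X ≡ multiWeight ws (map indicator X)
weightOf≡multiWeight []ᵥ      []ᵥ         = refl
weightOf≡multiWeight (a ∷ ws) (true ∷ X)  = cong₂ _+ℚ_ (sym (ℚ.+-identityʳ a)) (weightOf≡multiWeight ws X)
weightOf≡multiWeight (a ∷ ws) (false ∷ X) = trans (weightOf≡multiWeight ws X) (sym (ℚ.+-identityˡ _))

multiWeight-⊕ : (ws : Vec ℚ n) (u v : Vec ℕ n) → multiWeight ws (u ⊕ v) ≡ multiWeight ws u +ℚ multiWeight ws v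
multiWeight-⊕ []ᵥ      []ᵥ     []ᵥ     = sym (ℚ.+-identityˡ 0ℚ)
multiWeight-⊕ (a ∷ ws) (x ∷ u) (y ∷ v) =
  trans (cong₂ _+ℚ_ (×-homo-+ a x y) (multiWeight-⊕ ws u v)) (ℚ+.interchange (x × a) (y × a) _ _)

multiWeight-replicate : (ws : Vec ℚ n) (c : ℕ) → multiWeight ws (replicate n c) ≡ c × weightOf ws ⊤
multiWeight-replicate []ᵥ      zero    = refl
multiWeight-replicate []ᵥ      (suc c) = trans (multiWeight-replicate []ᵥ c) (sym (ℚ.+-identityˡ _))
multiWeight-replicate (a ∷ ws) c       =
  trans (cong (c × a +ℚ_) (multiWeight-replicate ws c)) (sym (×-distrib-+ a (weightOf ws ⊤) c))

∑ : ℕ → (ℕ → ℚ) → ℚ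
∑ zero    f = 0ℚ
∑ (suc m) f = f 0 +ℚ ∑ m (f ∘ suc)

∑-cong : ∀ m {f g : ℕ → ℚ} → (∀ j → f j ≡ g j) → ∑ m f ≡ ∑ m g
∑-cong zero    eq = refl
∑-cong (suc m) eq = cong₂ _+ℚ_ (eq 0) (∑-cong m (eq ∘ suc))

∑-mono-≤ : ∀ m {f g : ℕ → ℚ} → (∀ j → j < m → f j ≤ℚ g j) → ∑ m f ≤ℚ ∑ m g
∑-mono-≤ zero    le = ℚ.≤-refl
∑-mono-≤ (suc m) le = ℚ.+-mono-≤ (le 0 z<s) (∑-mono-≤ m (λ j j<m → le (suc j) (s<s j<m)))

∑-distrib-+ : ∀ m (f g : ℕ → ℚ) → ∑ m (λ j → f j +ℚ g j) ≡ ∑ m f +ℚ ∑ m g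
∑-distrib-+ zero    f g = sym (ℚ.+-identityˡ 0ℚ)
∑-distrib-+ (suc m) f g =
  trans (cong (f 0 +ℚ g 0 +ℚ_) (∑-distrib-+ m (f ∘ suc) (g ∘ suc))) (ℚ+.interchange (f 0) (g 0) _ _)

∑-const : ∀ m a → ∑ m (λ _ → a) ≡ m × a
∑-const zero    a = refl
∑-const (suc m) a = cong (a +ℚ_) (∑-const m a)

multiWeight-∑ᵥ : (ws : Vec ℚ n) (m : ℕ) (g : ℕ → Vec ℕ n) → multiWeight ws (∑ᵥ m g) ≡ ∑ m (multiWeight ws ∘ g)
multiWeight-∑ᵥ ws zero    g = multiWeight-replicate ws 0
multiWeight-∑ᵥ ws (suc m) g =
  trans (multiWeight-⊕ ws (g 0) _) (cong (multiWeight ws (g 0) +ℚ_) (multiWeight-∑ᵥ ws m (g ∘ suc)))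

∑-weightOf-rotateⁿ : (ws : Vec ℚ n) (X : Subset n) →
                     ∑ n (λ j → weightOf ws (rotateⁿ j X)) ≡ ∣ X ∣ × weightOf ws ⊤
∑-weightOf-rotateⁿ {n} ws X = begin
  ∑ n (λ j → weightOf ws (rotateⁿ j X))     ≡⟨ ∑-cong n multiWeight-rotation ⟩
  ∑ n (λ j → multiWeight ws (rotateⁿ j χ))  ≡⟨ multiWeight-∑ᵥ ws n (λ j → rotateⁿ j χ) ⟨
  multiWeight ws (∑ᵥ n (λ j → rotateⁿ j χ)) ≡⟨ cong (multiWeight ws) (∑ᵥ-rotations χ) ⟩
  multiWeight ws (replicate n (sum χ))      ≡⟨ multiWeight-replicate ws (sum χ) ⟩
  sum χ × weightOf ws ⊤                     ≡⟨ cong (_× weightOf ws ⊤) (sum-indicator X) ⟩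
  ∣ X ∣ × weightOf ws ⊤                     ∎
  where
  open ≡-Reasoning
  χ = map indicator X
  multiWeight-rotation : ∀ j → weightOf ws (rotateⁿ j X) ≡ multiWeight ws (rotateⁿ j χ)
  multiWeight-rotation j = trans (weightOf≡multiWeight ws (rotateⁿ j X))
                                 (cong (multiWeight ws) (sym (rotateⁿ-map indicator j X)))

weightOf-∁ : (ws : Vec ℚ n) (X : Subset n) → weightOf ws X +ℚ weightOf ws (∁ X) ≡ weightOf ws ⊤
weightOf-∁ []ᵥ      []ᵥ         = ℚ.+-identityˡ 0ℚ
weightOf-∁ (a ∷ ws) (true ∷ X)  = trans (ℚ.+-assoc a _ _) (cong (a +ℚ_) (weightOf-∁ ws X))
weightOf-∁ (a ∷ ws) (false ∷ X) = trans (ℚ+.x∙yz≈y∙xz (weightOf ws X) a _) (cong (a +ℚ_) (weightOf-∁ ws X))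

+-nonNeg : ∀ {x y} → 0ℚ ≤ℚ x → 0ℚ ≤ℚ y → 0ℚ ≤ℚ x +ℚ y
+-nonNeg 0≤x 0≤y = ℚ.≤-trans (ℚ.≤-reflexive (sym (ℚ.+-identityˡ 0ℚ))) (ℚ.+-mono-≤ 0≤x 0≤y)

x≤x+y : ∀ x {y} → 0ℚ ≤ℚ y → x ≤ℚ x +ℚ y
x≤x+y x 0≤y = ℚ.≤-trans (ℚ.≤-reflexive (sym (ℚ.+-identityʳ x))) (ℚ.+-monoʳ-≤ x 0≤y)

×-nonNeg : ∀ m {a} → 0ℚ ≤ℚ a → 0ℚ ≤ℚ m × a
×-nonNeg zero    0≤a = ℚ.≤-refl
×-nonNeg (suc m) 0≤a = +-nonNeg 0≤a (×-nonNeg m 0≤a)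

×-monoˡ-< : ∀ {a m k} → 0ℚ <ℚ a → m < k → m × a <ℚ k × a
×-monoˡ-< {a} {zero}  {suc k} 0<a z<s       =
  ℚ.<-respˡ-≡ (ℚ.+-identityʳ 0ℚ) (ℚ.+-mono-<-≤ 0<a (×-nonNeg k (ℚ.<⇒≤ 0<a)))
×-monoˡ-< {a} {suc m} {suc k} 0<a (s<s m<k) = ℚ.+-monoʳ-< a (×-monoˡ-< 0<a m<k)

k×a≤m×a⇒a≡0 : ∀ {a m k} → m < k → 0ℚ ≤ℚ a → k × a ≤ℚ m × a → a ≡ 0ℚ
k×a≤m×a⇒a≡0 m<k 0≤a k×a≤m×a = ℚ.≤-antisym
  (ℚ.≮⇒≥ λ 0<a → ℚ.<-irrefl refl (ℚ.≤-<-trans k×a≤m×a (×-monoˡ-< 0<a m<k)))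
  0≤a

weightOf-nonNeg : (ws : Vec ℚ n) → NonNeg ws → (X : Subset n) → 0ℚ ≤ℚ weightOf ws X
weightOf-nonNeg []ᵥ      _              []ᵥ         = ℚ.≤-refl
weightOf-nonNeg (a ∷ ws) (0≤a , ws≥0) (true ∷ X)  = +-nonNeg 0≤a (weightOf-nonNeg ws ws≥0 X)
weightOf-nonNeg (a ∷ ws) (0≤a , ws≥0) (false ∷ X) = weightOf-nonNeg ws ws≥0 X

weightOf≤total : (ws : Vec ℚ n) → NonNeg ws → (X : Subset n) → weightOf ws X ≤ℚ weightOf ws ⊤
weightOf≤total ws ws≥0 X =
  ℚ.≤-trans (x≤x+y (weightOf ws X) (weightOf-nonNeg ws ws≥0 (∁ X))) (ℚ.≤-reflexive (weightOf-∁ ws X))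

total≡0⇒¬SomeNonZero : (ws : Vec ℚ n) → NonNeg ws → weightOf ws ⊤ ≡ 0ℚ → ¬ SomeNonZero ws
total≡0⇒¬SomeNonZero (a ∷ ws) (0≤a , ws≥0) T≡0 (inj₁ a≢0) =
  a≢0 (ℚ.≤-antisym (subst (a ≤ℚ_) T≡0 (x≤x+y a (weightOf-nonNeg ws ws≥0 ⊤))) 0≤a)
total≡0⇒¬SomeNonZero (a ∷ ws) (0≤a , ws≥0) T≡0 (inj₂ ws≢0) =
  total≡0⇒¬SomeNonZero ws ws≥0 rest≡0 ws≢0
  where
  rest≡0 : weightOf ws ⊤ ≡ 0ℚ
  rest≡0 = ℚ.≤-antisym (subst (weightOf ws ⊤ ≤ℚ_) T≡0 (weightOf≤total (a ∷ ws) (0≤a , ws≥0) (false ∷ ⊤)))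
                       (weightOf-nonNeg ws ws≥0 ⊤)

module RoughQuota {G : Game n} (ws : Vec ℚ n) (q : ℚ)
  (below⇒losing : ∀ X → weightOf ws X <ℚ q → ¬ G X)
  (above⇒winning : ∀ X → q <ℚ weightOf ws X → G X) where

  quota≤winning : ∀ {X} → G X → q ≤ℚ weightOf ws X
  quota≤winning {X} X-wins = ℚ.≮⇒≥ (λ X<q → below⇒losing X X<q X-wins)

  complement≤quota : Proper G → ∀ {X} → G X → weightOf ws (∁ X) ≤ℚ q
  complement≤quota proper {X} X-wins = ℚ.≮⇒≥ (λ q<∁X → proper X X-wins (above⇒winning (∁ X) q<∁X))

  total≤twice-winning : Proper G → ∀ {X} → G X → weightOf ws ⊤ ≤ℚ weightOf ws X +ℚ weightOf ws X
  total≤twice-winning proper {X} X-wins =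
    ℚ.≤-trans (ℚ.≤-reflexive (sym (weightOf-∁ ws X)))
      (ℚ.+-monoʳ-≤ (weightOf ws X) (ℚ.≤-trans (complement≤quota proper X-wins) (quota≤winning X-wins)))

rotateⁿ-winning : (w : Subset n) → ∀ {j} → j < n → Cyclic w (rotateⁿ j w)
rotateⁿ-winning w {j} j<n = fromℕ< j<n , subst (λ k → rotateⁿ k w ⊆ rotateⁿ j w) (sym (toℕ-fromℕ< j<n)) id

theorem8 : (n : ℕ) (w : Subset n) → 2 * ∣ w ∣ < n → Proper (Cyclic w) → ¬ RoughlyWeighted (Cyclic w)
theorem8 zero      _ () _
theorem8 n@(suc _) w 2∣w∣<n proper (ws , q , ws≥0 , nontrivial , below⇒losing , above⇒winning) =
  [ total≡0⇒¬SomeNonZero ws ws≥0 total≡0 , (λ q≢0 → q≢0 q≡0) ] nontrivial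
  where
  open RoughQuota ws q below⇒losing above⇒winning
  open ℚ.≤-Reasoning
  T = weightOf ws ⊤
  shift : ℕ → ℚ
  shift j = weightOf ws (rotateⁿ j w)
  nT≤2∣w∣T : n × T ≤ℚ (∣ w ∣ + ∣ w ∣) × T
  nT≤2∣w∣T = begin
    n × T                          ≡⟨ ∑-const n T ⟨
    ∑ n (λ _ → T)                  ≤⟨ ∑-mono-≤ n (λ j j<n → total≤twice-winning proper (rotateⁿ-winning w j<n)) ⟩
    ∑ n (λ j → shift j +ℚ shift j) ≡⟨ ∑-distrib-+ n shift shift ⟩
    ∑ n shift +ℚ ∑ n shift         ≡⟨ cong₂ _+ℚ_ (∑-weightOf-rotateⁿ ws w) (∑-weightOf-rotateⁿ ws w) ⟩
    ∣ w ∣ × T +ℚ ∣ w ∣ × T         ≡⟨ ×-homo-+ T ∣ w ∣ ∣ w ∣ ⟨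
    (∣ w ∣ + ∣ w ∣) × T            ∎
  total≡0 : T ≡ 0ℚ
  total≡0 = k×a≤m×a⇒a≡0 (subst (_< n) (cong (∣ w ∣ +_) (ℕ.+-identityʳ ∣ w ∣)) 2∣w∣<n)
                         (weightOf-nonNeg ws ws≥0 ⊤) nT≤2∣w∣T
  q≡0 : q ≡ 0ℚ
  q≡0 = ℚ.≤-antisym
    (subst (q ≤ℚ_) total≡0 (ℚ.≤-trans (quota≤winning w-wins) (weightOf≤total ws ws≥0 w)))
    (ℚ.≤-trans (weightOf-nonNeg ws ws≥0 (∁ w)) (complement≤quota proper w-wins))
    where
    w-wins : Cyclic w w
    w-wins = rotateⁿ-winning w {0} z<s
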